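{- Let $G$ be a graph that is uniquely distinguishing $n$-colorable, with $n\neq |V(G)|$. Then $G$ is uniquely distinguishing colorable and $\chi_D(G)=n$.
   Context: A distinguishing $k$-coloring of a graph $G$ is a partition of $V(G)$ into exactly $k$ non-empty independent sets such that the only automorphism of $G$ mapping every class onto itself is the identity; $\chi_D(G)$ is the least such $k$. $G$ is uniquely distinguishing $n$-colorable if it has exactly one distinguishing $n$-coloring, and uniquely distinguishing colorable if it is uniquely distinguishing $\chi_D(G)$-colorable. -}

module Defs where

open import Data.Nat using (ℕ; _<_)
open import Data.Fin using (Fin)
open import Data.Fin.Permutation using (Permutation′; _⟨$⟩ʳ_)
open import Data.Bool using (Bool; true; false)
open import Data.Product using (Σ; ∃; _×_)
open import Relation.Binary.PropositionalEquality using (_≡_)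
open import Relation.Nullary using (¬_)
open import Function.Bundles using (_⇔_)

record Graph : Set where
  field
    V         : ℕ
    adj       : Fin V → Fin V → Bool
    adj-sym   : ∀ x y → adj x y ≡ adj y x
    adj-irrefl : ∀ x → adj x x ≡ false
open Graph public

IsAutomorphism : (G : Graph) → Permutation′ (V G) → Set
IsAutomorphism G σ = ∀ x y → adj G (σ ⟨$⟩ʳ x) (σ ⟨$⟩ʳ y) ≡ adj G x y

-- A k-coloring given by a colour map c; its classes are the fibres c⁻¹(i).
-- "Partition into exactly k non-empty independent sets": c proper and surjective.
IsProper : (G : Graph) {k : ℕ} → (Fin (V G) → Fin k) → Set
IsProper G c = ∀ x y → adj G x y ≡ true → ¬ (c x ≡ c y)

IsSurjective : {m k : ℕ} → (Fin m → Fin k) → Set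
IsSurjective {k = k} c = ∀ (i : Fin k) → ∃ λ x → c x ≡ i

IsDistinguishingMap : (G : Graph) {k : ℕ} → (Fin (V G) → Fin k) → Set
IsDistinguishingMap G c =
  ∀ (σ : Permutation′ (V G)) → IsAutomorphism G σ →
    (∀ x → c (σ ⟨$⟩ʳ x) ≡ c x) → ∀ x → σ ⟨$⟩ʳ x ≡ x

IsDistinguishingColoring : (G : Graph) (k : ℕ) → (Fin (V G) → Fin k) → Set
IsDistinguishingColoring G k c = IsProper G c × IsSurjective c × IsDistinguishingMap G c

-- Two colour maps induce the same partition of V(G) (colourings are partitions,
-- so they are identified up to renaming of colours).
SamePartition : (G : Graph) {k l : ℕ} → (Fin (V G) → Fin k) → (Fin (V G) → Fin l) → Set
SamePartition G c d = ∀ x y → (c x ≡ c y) ⇔ (d x ≡ d y)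

DistinguishingColorable : Graph → ℕ → Set
DistinguishingColorable G k = ∃ λ (c : Fin (V G) → Fin k) → IsDistinguishingColoring G k c

IsDistinguishingChromaticNumber : Graph → ℕ → Set
IsDistinguishingChromaticNumber G k =
  DistinguishingColorable G k × (∀ j → j < k → ¬ DistinguishingColorable G j)

UniquelyDistinguishingColorableWith : Graph → ℕ → Set
UniquelyDistinguishingColorableWith G k =
  Σ (Fin (V G) → Fin k) λ c → IsDistinguishingColoring G k c ×
    (∀ (d : Fin (V G) → Fin k) → IsDistinguishingColoring G k d → SamePartition G c d)

UniquelyDistinguishingColorable : Graph → Set
UniquelyDistinguishingColorable G =
  ∃ λ k → IsDistinguishingChromaticNumber G k × UniquelyDistinguishingColorableWith G k

{-# OPTIONS --safe #-}
module Submission where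

-- Distinguishing colourings can be refined: isolating one vertex of a class with at least two
-- vertices keeps the colouring proper and distinguishing and adds one colour. So a
-- distinguishing j-colouring with j < n < |V(G)| refines to a distinguishing (n - 1)-colouring e,
-- and since e has at most |V(G)| - 2 colours it can be refined to an n-colouring in two ways
-- that give different partitions: isolate a vertex x, or isolate a vertex u ≠ x and keep x
-- together with one of its classmates.

open import Defs
open import Data.Nat using (ℕ; suc; _≤_; _<_; _≤′_; ≤′-refl; ≤′-step; s≤s)
open import Data.Nat.Properties using (≤-trans; n≤1+n; <⇒≤; ≤∧≢⇒<; ≤⇒≤′)
open import Data.Fin using (Fin; zero; suc; punchIn)
open import Data.Fin.Properties
  using (_≟_; suc-injective; pigeonhole; injective⇒≤; <⇒≢; punchIn-injective; punchInᵢ≢i)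
open import Data.Product using (_×_; _,_; proj₁; proj₂)
open import Function using (_∘_)
open import Function.Bundles using (Equivalence)
open import Relation.Nullary using (¬_; yes; no; contradiction)
open import Relation.Binary.PropositionalEquality using (_≡_; _≢_; refl; sym; trans; cong)

surjective⇒≤ : ∀ {m k} (c : Fin m → Fin k) → IsSurjective c → k ≤ m
surjective⇒≤ c surj = injective⇒≤ {f = λ i → proj₁ (surj i)} λ {i} {j} eq →
  trans (sym (proj₂ (surj i))) (trans (cong c eq) (proj₂ (surj j)))

module _ (G : Graph) {k l : ℕ} (c : Fin (V G) → Fin k) (d : Fin (V G) → Fin l)
         (d-refines-c : ∀ x y → d x ≡ d y → c x ≡ c y) where

  refine-isProper : IsProper G c → IsProper G d
  refine-isProper proper x y xy-adj = proper x y xy-adj ∘ d-refines-c x y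

  refine-isDistinguishingMap : IsDistinguishingMap G c → IsDistinguishingMap G d
  refine-isDistinguishingMap distinguishing σ σ-aut σ-fixes-d =
    distinguishing σ σ-aut λ x → d-refines-c _ _ (σ-fixes-d x)

module _ {N k : ℕ} (c : Fin N → Fin k) (x : Fin N) where

  isolate : Fin N → Fin (suc k)
  isolate v with v ≟ x
  ... | yes _ = zero
  ... | no _  = suc (c v)

  isolate-self : isolate x ≡ zero
  isolate-self with x ≟ x
  ... | yes _  = refl
  ... | no x≢x = contradiction refl x≢x

  isolate-other : ∀ {v} → v ≢ x → isolate v ≡ suc (c v)
  isolate-other {v} v≢x with v ≟ x
  ... | yes v≡x = contradiction v≡x v≢x
  ... | no _    = refl

  isolate-refines : ∀ v w → isolate v ≡ isolate w → c v ≡ c w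
  isolate-refines v w eq with v ≟ x | w ≟ x
  ... | yes refl | yes refl = refl
  ... | yes _    | no _     with () ← eq
  ... | no _     | yes _    with () ← eq
  ... | no _     | no _     = suc-injective eq

  isolate-isolated : ∀ {v} → isolate v ≡ isolate x → v ≡ x
  isolate-isolated {v} eq with v ≟ x
  ... | yes v≡x = v≡x
  ... | no _    with () ← trans eq isolate-self

  isolate-surjective : ∀ {y} → y ≢ x → c y ≡ c x → IsSurjective c → IsSurjective isolate
  isolate-surjective y≢x cy≡cx surj zero    = x , isolate-self
  isolate-surjective y≢x cy≡cx surj (suc i) with surj i
  ... | w , cw≡i with w ≟ x
  ...   | yes refl = _ , trans (isolate-other y≢x) (cong suc (trans cy≡cx cw≡i))
  ...   | no w≢x   = w , trans (isolate-other w≢x) (cong suc cw≡i)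

isolate-isDistinguishingColoring :
  (G : Graph) {k : ℕ} {c : Fin (V G) → Fin k} → IsDistinguishingColoring G k c →
  ∀ {x y} → y ≢ x → c y ≡ c x → IsDistinguishingColoring G (suc k) (isolate c x)
isolate-isDistinguishingColoring G {c = c} (proper , surj , distinguishing) {x} y≢x cy≡cx =
  refine-isProper G c (isolate c x) (isolate-refines c x) proper ,
  isolate-surjective c x y≢x cy≡cx surj ,
  refine-isDistinguishingMap G c (isolate c x) (isolate-refines c x) distinguishing

distinguishingColorable-suc :
  (G : Graph) {k : ℕ} → k < V G → DistinguishingColorable G k → DistinguishingColorable G (suc k)
distinguishingColorable-suc G k<V (c , c-dist) with pigeonhole k<V c
... | a , b , a<b , ca≡cb = isolate c b , isolate-isDistinguishingColoring G c-dist (<⇒≢ a<b) ca≡cb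

distinguishingColorable-mono :
  (G : Graph) {j k : ℕ} → j ≤′ k → k ≤ V G → DistinguishingColorable G j → DistinguishingColorable G k
distinguishingColorable-mono G ≤′-refl         k≤V dj = dj
distinguishingColorable-mono G (≤′-step j≤′k) k≤V dj =
  distinguishingColorable-suc G k≤V (distinguishingColorable-mono G j≤′k (≤-trans (n≤1+n _) k≤V) dj)

record SeparatedCollisions {N k : ℕ} (e : Fin N → Fin k) : Set where
  field
    x q u w : Fin N
    q≢x     : q ≢ x
    eq≡ex   : e q ≡ e x
    q≢u     : q ≢ u
    u≢x     : u ≢ x
    w≢u     : w ≢ u
    ew≡eu   : e w ≡ e u

-- Two collisions by pigeonhole, the second among vertices other than the first's x. If the
-- partner of x happens to be u, then the partner w of u is a partner of x as well.
separatedCollisions : ∀ {N k} (e : Fin N → Fin k) → suc k < N → SeparatedCollisions e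
separatedCollisions {suc N} e (s≤s k<N) with pigeonhole (≤-trans k<N (n≤1+n N)) e
... | a , x , a<x , ea≡ex with pigeonhole k<N (e ∘ punchIn x)
... | i , j , i<j , ei≡ej with a ≟ punchIn x i
...   | yes refl = record
  { x = x ; q = punchIn x j ; u = punchIn x i ; w = punchIn x j
  ; q≢x = punchInᵢ≢i x j ; eq≡ex = trans (sym ei≡ej) ea≡ex
  ; q≢u = <⇒≢ i<j ∘ sym ∘ punchIn-injective x j i
  ; u≢x = punchInᵢ≢i x i ; w≢u = <⇒≢ i<j ∘ sym ∘ punchIn-injective x j i
  ; ew≡eu = sym ei≡ej }
...   | no a≢u = record
  { x = x ; q = a ; u = punchIn x i ; w = punchIn x j
  ; q≢x = <⇒≢ a<x ; eq≡ex = ea≡ex ; q≢u = a≢u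
  ; u≢x = punchInᵢ≢i x i ; w≢u = <⇒≢ i<j ∘ sym ∘ punchIn-injective x j i
  ; ew≡eu = sym ei≡ej }

¬uniquelyDistinguishingColorableWith-suc :
  (G : Graph) {k : ℕ} → DistinguishingColorable G k → suc k < V G →
  ¬ UniquelyDistinguishingColorableWith G (suc k)
¬uniquelyDistinguishingColorableWith-suc G (e , e-dist) 1+k<V (c , _ , unique) =
  q≢x (isolate-isolated e x (sym x∼q-in-isolate-x))
  where
  open SeparatedCollisions (separatedCollisions e 1+k<V)
  open Equivalence

  x∼q-in-isolate-u : isolate e u x ≡ isolate e u q
  x∼q-in-isolate-u = trans (isolate-other e u (u≢x ∘ sym))
                       (trans (cong suc (sym eq≡ex)) (sym (isolate-other e u q≢u)))

  x∼q-in-c : c x ≡ c q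
  x∼q-in-c = from (unique _ (isolate-isDistinguishingColoring G e-dist w≢u ew≡eu) x q) x∼q-in-isolate-u

  x∼q-in-isolate-x : isolate e x x ≡ isolate e x q
  x∼q-in-isolate-x = to (unique _ (isolate-isDistinguishingColoring G e-dist q≢x eq≡ex) x q) x∼q-in-c

uniquelyDistinguishingColorableWith⇒no-fewer :
  (G : Graph) {n : ℕ} → UniquelyDistinguishingColorableWith G n → n < V G →
  ∀ j → j < n → ¬ DistinguishingColorable G j
uniquelyDistinguishingColorableWith⇒no-fewer G unique n<V j (s≤s j≤m) dj =
  ¬uniquelyDistinguishingColorableWith-suc G
    (distinguishingColorable-mono G (≤⇒≤′ j≤m) (≤-trans (n≤1+n _) (<⇒≤ n<V)) dj) n<V unique

proposition2p2 : (G : Graph) (n : ℕ) → UniquelyDistinguishingColorableWith G n →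
    n ≢ V G → UniquelyDistinguishingColorable G × IsDistinguishingChromaticNumber G n
proposition2p2 G n unique@(c , c-dist@(_ , c-surj , _) , _) n≢V = (n , χD≡n , unique) , χD≡n
  where
  n<V : n < V G
  n<V = ≤∧≢⇒< (surjective⇒≤ c c-surj) n≢V

  χD≡n : IsDistinguishingChromaticNumber G n
  χD≡n = (c , c-dist) , uniquelyDistinguishingColorableWith⇒no-fewer G unique n<V
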